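{- Let $A$ be a set, let $0$ be an element of $A$, let $p$ be a prime, let $k \in \mathbb{N}_0$, let $n, m \in \mathbb{N}$, and let $f_1, \ldots, f_m : A^n \to \mathbb{Z}_p$ be functions each of absorbing degree at most $k$. Let $\mathbf{a} \in A^n$. Then there is $U \subseteq \{1,\ldots,n\}$ with $|U| \le km(p-1)$ such that for all $i \in \{1,\ldots,m\}$, we have $f_i (\mathbf{a}) = f_i (\mathbf{a}|_{U})$.
   Context: For $\mathbf{a}\in A^n$ and $J\subseteq\{1,\ldots,n\}$, $\mathbf{a}|_J\in A^n$ is defined by $\mathbf{a}|_J(j)=\mathbf{a}(j)$ for $j\in J$ and $\mathbf{a}|_J(j)=0$ for $j\notin J$. For an abelian group $(B;+,-,0)$ and $g:A^n\to B$: $g$ is absorbing in $I\subseteq\{1,\ldots,n\}$ if $g$ depends only on its arguments with indices in $I$, and $g(\mathbf{a})=0$ whenever $\mathbf{a}(i)=0$ for some $i\in I$. Every $g:A^n\to B$ can be written uniquely as $g=\sum_{I\subseteq\{1,\ldots,n\}} g_I$ with each $g_I:A^n\to B$ absorbing in $I$ (the absorbing decomposition). The absorbing degree of $g$ is $\mathrm{adeg}(g):=\max(\{ -1\}\cup\{|J| : J\subseteq\{1,\ldots,n\},\ g_J\neq 0\})$. Here $\mathbb{Z}_p$ is regarded as an abelian group under addition. -}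

module Defs where

open import Data.Nat using (ℕ; zero; suc; _+_; _<_; NonZero)
open import Data.Nat.DivMod using (_mod_)
open import Data.Nat.Primality using (Prime; prime⇒nonZero)
open import Data.Fin using (Fin; toℕ)
open import Data.Fin.Subset using (Subset; _∈_; ∣_∣)
open import Data.Bool using (true; false; if_then_else_)
open import Data.Vec using (Vec; []; _∷_; lookup)
open import Data.List using (List; []; _∷_; map; _++_; foldr)
open import Relation.Binary.PropositionalEquality using (_≡_)
open import Data.Product using (Σ; _×_)

ℤ_ : ℕ → Set
ℤ_ p = Fin p

module _ {p : ℕ} (pp : Prime p) where
  private instance _ = prime⇒nonZero pp
  zeroₚ : ℤ_ p
  zeroₚ = 0 mod p
  addₚ : ℤ_ p → ℤ_ p → ℤ_ p
  addₚ x y = (toℕ x + toℕ y) mod p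

allSubsets : (n : ℕ) → List (Subset n)
allSubsets zero = [] ∷ []
allSubsets (suc n) = map (true ∷_) (allSubsets n) ++ map (false ∷_) (allSubsets n)

restrict : {A : Set} {n : ℕ} (z : A) → (Fin n → A) → Subset n → (Fin n → A)
restrict z a J j = if lookup J j then a j else z

-- Definitions relative to an (additive) abelian group (B; +, 0);
-- only the operation and zero are needed to state them.
module _ {A : Set} (z : A) {B : Set} (_⊕_ : B → B → B) (ε : B) where

  Absorbing : {n : ℕ} → Subset n → ((Fin n → A) → B) → Set
  Absorbing {n} I g =
    ((a b : Fin n → A) → (∀ i → i ∈ I → a i ≡ b i) → g a ≡ g b)
    × ((a : Fin n → A) (i : Fin n) → i ∈ I → a i ≡ z → g a ≡ ε)

  IsAbsorbingDecomposition : {n : ℕ} → ((Fin n → A) → B) → (Subset n → (Fin n → A) → B) → Set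
  IsAbsorbingDecomposition {n} g gs =
    ((I : Subset n) → Absorbing I (gs I))
    × ((a : Fin n → A) → g a ≡ foldr _⊕_ ε (map (λ I → gs I a) (allSubsets n)))

  -- adeg(g) ≤ k : the (unique) absorbing decomposition has g_J = 0 whenever |J| > k.
  AdegAtMost : {n : ℕ} → ℕ → ((Fin n → A) → B) → Set
  AdegAtMost {n} k g =
    Σ (Subset n → (Fin n → A) → B) λ gs →
      IsAbsorbingDecomposition g gs
      × ((J : Subset n) → k < ∣ J ∣ → (a : Fin n → A) → gs J a ≡ ε)

-- The proof is the polynomial method on the Boolean cube {0,1}^n, with x ∈ {0,1}^n standing
-- for the restriction a|_x.  Since each g_I in the absorbing decomposition of f_i is absorbing
-- in I, g_I(a|_x) is g_I(a) when I ⊆ x and 0 otherwise; hence f_i(a|_x) - f_i(a) is, modulo p,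
-- the value at x of an integer multilinear polynomial Q_i of degree at most k with Q_i(1…1) = 0.
-- The product χ = ∏_i ∏_{c=1}^{p-1} (Q_i - c) has degree at most km(p-1) and is nonzero modulo p
-- exactly at the common roots of the Q_i.  At a common root U with |U| > km(p-1), the alternating
-- sum of χ over the points below U extracts the coefficient of a monomial of degree |U|, so it
-- vanishes; modulo p this forces another common root of smaller weight.  Descending from U = 1…1
-- gives the bound.

module Submission where

open import Defs
open import Data.Nat as ℕ using (ℕ; zero; suc; _≤_; _<_; _∸_; z≤n; s≤s)
import Data.Nat.Properties as ℕₚ
import Data.Nat.Divisibility as ℕᵈ
open import Data.Nat.ListAction using (sum)
open import Data.Nat.Primality using (Prime; prime⇒nonZero)
open import Data.Integer as ℤ using (ℤ; +_; _+_; _-_; 0ℤ; 1ℤ)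
import Data.Integer.Properties as ℤₚ
open import Data.Integer.Divisibility.Signed
  using (_∣_; divides; _∣?_; ∣m∣n⇒∣m-n; ∣m⇒∣-m; ∣m⇒∣m*n; ∣n⇒∣m*n; ∣⇒∣ᵤ; ∣ᵤ⇒∣)
import Data.Integer.Tactic.RingSolver as ℤ-Solver
open import Data.Bool using (Bool; true; false; _∧_; if_then_else_)
open import Data.Fin as Fin using (Fin; toℕ)
open import Data.Fin.Subset using (Subset; ∣_∣; _∈_)
open import Data.List using (List; []; _∷_; map; foldr)
open import Data.Product using (Σ; _×_; _,_; proj₁; proj₂)
open import Data.Sum using (_⊎_; inj₁; inj₂)
open import Function using (_∘_; const)
open import Relation.Nullary using (¬_; yes; no; contradiction)
open import Relation.Binary.PropositionalEquality

module CubeFunctions where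

  open import Data.Integer using (_*_; -_)
  open import Data.Unit using (⊤; tt)
  open import Data.Vec using ([]; _∷_; lookup; here; there)

  private variable
    n d e : ℕ

  CubeFn : ℕ → Set
  CubeFn n = Subset n → ℤ

  face₀ face₁ : CubeFn (suc n) → CubeFn n
  face₀ F x = F (false ∷ x)
  face₁ F x = F (true ∷ x)

  _⊕_ _⊝_ _⊛_ : CubeFn n → CubeFn n → CubeFn n
  (F ⊕ G) x = F x + G x
  (F ⊝ G) x = F x - G x
  (F ⊛ G) x = F x * G x

  ∂ : CubeFn (suc n) → CubeFn n
  ∂ F = face₁ F ⊝ face₀ F

  ∂-⊕ : (F G : CubeFn (suc n)) → ∂ (F ⊕ G) ≗ ∂ F ⊕ ∂ G
  ∂-⊕ F G x = identity (F (true ∷ x)) (F (false ∷ x)) (G (true ∷ x)) (G (false ∷ x))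
    where
    identity : ∀ a b c d → (a + c) - (b + d) ≡ (a - b) + (c - d)
    identity = ℤ-Solver.solve-∀

  ∂-⊛ : (F G : CubeFn (suc n)) → ∂ (F ⊛ G) ≗ (∂ F ⊛ face₁ G) ⊕ (face₀ F ⊛ ∂ G)
  ∂-⊛ F G x = leibniz (F (true ∷ x)) (F (false ∷ x)) (G (true ∷ x)) (G (false ∷ x))
    where
    leibniz : ∀ a b c d → a * c - b * d ≡ (a - b) * c + b * (c - d)
    leibniz = ℤ-Solver.solve-∀

  face₀⊕∂≗face₁ : (F : CubeFn (suc n)) → face₀ F ⊕ ∂ F ≗ face₁ F
  face₀⊕∂≗face₁ F x = identity (F (true ∷ x)) (F (false ∷ x))
    where
    identity : ∀ a b → b + (a - b) ≡ a
    identity = ℤ-Solver.solve-∀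

  -- Deg≤ U d F: on the points below U (coordinates outside U fixed to false) F is a multilinear
  -- polynomial of degree ≤ d, unfolding F = face₀ F + x₁ · ∂ F; Deg< U 0 F means F = 0.
  mutual
    Deg≤ : Subset n → ℕ → CubeFn n → Set
    Deg≤ []          d F = ⊤
    Deg≤ (true  ∷ U) d F = Deg≤ U d (face₀ F) × Deg< U d (∂ F)
    Deg≤ (false ∷ U) d F = Deg≤ U d (face₀ F)

    Deg< : Subset n → ℕ → CubeFn n → Set
    Deg< U zero    F = F ≗ const 0ℤ
    Deg< U (suc d) F = Deg≤ U d F

  mutual
    Deg≤-cong : ∀ U {F G : CubeFn n} → F ≗ G → Deg≤ U d F → Deg≤ U d G
    Deg≤-cong         []          F≗G _         = tt
    Deg≤-cong {d = d} (true  ∷ U) F≗G (f₀ , f∂) =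
      Deg≤-cong U (λ x → F≗G (false ∷ x)) f₀ ,
      Deg<-cong U d (λ x → cong₂ _-_ (F≗G (true ∷ x)) (F≗G (false ∷ x))) f∂
    Deg≤-cong         (false ∷ U) F≗G f₀        = Deg≤-cong U (λ x → F≗G (false ∷ x)) f₀

    Deg<-cong : ∀ U d {F G : CubeFn n} → F ≗ G → Deg< U d F → Deg< U d G
    Deg<-cong U zero    F≗G F≗0 x = trans (sym (F≗G x)) (F≗0 x)
    Deg<-cong U (suc d) F≗G f     = Deg≤-cong U F≗G f

  mutual
    Deg≤-zero : ∀ (U : Subset n) → Deg≤ U d (const 0ℤ)
    Deg≤-zero             []          = tt
    Deg≤-zero {d = d}     (true  ∷ U) = Deg≤-zero U , Deg<-zero U d
    Deg≤-zero             (false ∷ U) = Deg≤-zero U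

    Deg<-zero : ∀ (U : Subset n) d → Deg< U d (const 0ℤ)
    Deg<-zero U zero    x = refl
    Deg<-zero U (suc d)   = Deg≤-zero U

  Deg≤-const : ∀ (U : Subset n) c → Deg≤ U 0 (const c)
  Deg≤-const []          c = tt
  Deg≤-const (true  ∷ U) c = Deg≤-const U c , λ _ → ℤₚ.+-inverseʳ c
  Deg≤-const (false ∷ U) c = Deg≤-const U c

  mutual
    Deg≤-mono : ∀ U {F : CubeFn n} → d ≤ e → Deg≤ U d F → Deg≤ U e F
    Deg≤-mono []          d≤e _         = tt
    Deg≤-mono (true  ∷ U) d≤e (f₀ , f∂) = Deg≤-mono U d≤e f₀ , Deg<-mono U d≤e f∂
    Deg≤-mono (false ∷ U) d≤e f₀        = Deg≤-mono U d≤e f₀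

    Deg<-mono : ∀ U {F : CubeFn n} → d ≤ e → Deg< U d F → Deg< U e F
    Deg<-mono {e = e} U z≤n       F≗0 = Deg<-cong U e (λ x → sym (F≗0 x)) (Deg<-zero U e)
    Deg<-mono         U (s≤s d≤e) f   = Deg≤-mono U d≤e f

  Deg<⇒Deg≤ : ∀ U {F : CubeFn n} → Deg< U d F → Deg≤ U d F
  Deg<⇒Deg≤ {d = zero}  U F≗0 = Deg≤-cong U (λ x → sym (F≗0 x)) (Deg≤-zero U)
  Deg<⇒Deg≤ {d = suc d} U f   = Deg≤-mono U (ℕₚ.n≤1+n d) f

  mutual
    Deg≤-+ : ∀ U {F G : CubeFn n} → Deg≤ U d F → Deg≤ U d G → Deg≤ U d (F ⊕ G)
    Deg≤-+         []                  _         _         = tt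
    Deg≤-+ {d = d} (true  ∷ U) {F} {G} (f₀ , f∂) (g₀ , g∂) =
      Deg≤-+ U f₀ g₀ , Deg<-cong U d (λ x → sym (∂-⊕ F G x)) (Deg<-+ U d f∂ g∂)
    Deg≤-+         (false ∷ U)         f₀        g₀        = Deg≤-+ U f₀ g₀

    Deg<-+ : ∀ U d {F G : CubeFn n} → Deg< U d F → Deg< U d G → Deg< U d (F ⊕ G)
    Deg<-+ U zero    F≗0 G≗0 x = cong₂ _+_ (F≗0 x) (G≗0 x)
    Deg<-+ U (suc d) f   g     = Deg≤-+ U f g

  mutual
    Deg≤-* : ∀ U {F G : CubeFn n} → Deg≤ U d F → Deg≤ U e G → Deg≤ U (d ℕ.+ e) (F ⊛ G)
    Deg≤-*                 []                  _         _         = tt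
    Deg≤-* {d = d} {e = e} (true  ∷ U) {F} {G} (f₀ , f∂) (g₀ , g∂) =
      Deg≤-* U f₀ g₀ ,
      Deg<-cong U (d ℕ.+ e) (λ x → sym (∂-⊛ F G x))
        (Deg<-+ U (d ℕ.+ e) (Deg<-*ˡ U d e f∂ g₁) (Deg<-*ʳ U d e f₀ g∂))
      where
      g₁ : Deg≤ U e (face₁ G)
      g₁ = Deg≤-cong U (face₀⊕∂≗face₁ G) (Deg≤-+ U g₀ (Deg<⇒Deg≤ U g∂))
    Deg≤-*                 (false ∷ U)         f₀        g₀        = Deg≤-* U f₀ g₀

    Deg<-*ˡ : ∀ U d e {F G : CubeFn n} → Deg< U d F → Deg≤ U e G → Deg< U (d ℕ.+ e) (F ⊛ G)
    Deg<-*ˡ U zero    e {G = G} F≗0 _ = Deg<-cong U e (λ x → sym (cong (_* G x) (F≗0 x))) (Deg<-zero U e)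
    Deg<-*ˡ U (suc d) e         f   g = Deg≤-* U f g

    Deg<-*ʳ : ∀ U d e {F G : CubeFn n} → Deg≤ U d F → Deg< U e G → Deg< U (d ℕ.+ e) (F ⊛ G)
    Deg<-*ʳ U d e {F} {G} f g =
      subst (λ t → Deg< U t (F ⊛ G)) (ℕₚ.+-comm e d)
        (Deg<-cong U (e ℕ.+ d) (λ x → ℤₚ.*-comm (G x) (F x)) (Deg<-*ˡ U e d g f))

  Deg≤-- : ∀ U {F G : CubeFn n} → Deg≤ U d F → Deg≤ U d G → Deg≤ U d (F ⊝ G)
  Deg≤-- U {F} {G} f g =
    Deg≤-cong U (λ x → identity (F x) (G x)) (Deg≤-+ U f (Deg≤-* U (Deg≤-const U (- 1ℤ)) g))
    where
    identity : ∀ a b → a + - 1ℤ * b ≡ a - b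
    identity = ℤ-Solver.solve-∀

  ∏ : ∀ {m} → (Fin m → ℤ) → ℤ
  ∏ {zero}  h = 1ℤ
  ∏ {suc m} h = h Fin.zero * ∏ (λ i → h (Fin.suc i))

  Deg≤-∏ : ∀ U {m} (h : Fin m → CubeFn n) → (∀ i → Deg≤ U d (h i)) →
           Deg≤ U (m ℕ.* d) (λ x → ∏ λ i → h i x)
  Deg≤-∏ U {zero}  h degs = Deg≤-const U 1ℤ
  Deg≤-∏ U {suc m} h degs =
    Deg≤-* U (degs Fin.zero) (Deg≤-∏ U (λ i → h (Fin.suc i)) (λ i → degs (Fin.suc i)))

  ∑ : {X : Set} → List X → (X → ℤ) → ℤ
  ∑ []       h = 0ℤ
  ∑ (y ∷ ys) h = h y + ∑ ys h

  pos-sum : ∀ {X : Set} (L : List X) (g : X → ℕ) (h : X → ℤ) → (∀ y → + g y ≡ h y) →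
          + sum (map g L) ≡ ∑ L h
  pos-sum []      g h g≗h = refl
  pos-sum (y ∷ L) g h g≗h = trans (ℤₚ.pos-+ (g y) _) (cong₂ _+_ (g≗h y) (pos-sum L g h g≗h))

  Deg≤-∑ : ∀ U {X : Set} (L : List X) (h : X → CubeFn n) → (∀ y → Deg≤ U d (h y)) →
           Deg≤ U d (λ x → ∑ L λ y → h y x)
  Deg≤-∑ U []      h degs = Deg≤-zero U
  Deg≤-∑ U (y ∷ L) h degs = Deg≤-+ U (degs y) (Deg≤-∑ U L h degs)

  _⊆ᵇ_ : Subset n → Subset n → Bool
  []          ⊆ᵇ []      = true
  (true  ∷ I) ⊆ᵇ (b ∷ x) = b ∧ I ⊆ᵇ x
  (false ∷ I) ⊆ᵇ (_ ∷ x) = I ⊆ᵇ x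

  Ind : Subset n → CubeFn n
  Ind I x = if I ⊆ᵇ x then 1ℤ else 0ℤ

  Deg≤-Ind : ∀ (I U : Subset n) → Deg≤ U ∣ I ∣ (Ind I)
  Deg≤-Ind []          []          = tt
  Deg≤-Ind (true  ∷ I) (true  ∷ U) =
    Deg≤-zero U , Deg≤-cong U (λ x → sym (ℤₚ.+-identityʳ (Ind I x))) (Deg≤-Ind I U)
  Deg≤-Ind (true  ∷ I) (false ∷ U) = Deg≤-zero U
  Deg≤-Ind (false ∷ I) (true  ∷ U) =
    Deg≤-Ind I U , Deg<-cong U ∣ I ∣ (λ x → sym (ℤₚ.+-inverseʳ (Ind I x))) (Deg<-zero U ∣ I ∣)
  Deg≤-Ind (false ∷ I) (false ∷ U) = Deg≤-Ind I U

  -- Δ U F = Σ_{V ⊆ U} (-1)^(|U| - |V|) F V, the coefficient of the top monomial of F below U.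
  Δ : Subset n → CubeFn n → ℤ
  Δ []          F = F []
  Δ (true  ∷ U) F = Δ U (∂ F)
  Δ (false ∷ U) F = Δ U (face₀ F)

  Δ-zero : ∀ (U : Subset n) {F} → F ≗ const 0ℤ → Δ U F ≡ 0ℤ
  Δ-zero []          F≗0 = F≗0 []
  Δ-zero (true  ∷ U) F≗0 = Δ-zero U (λ x → cong₂ _-_ (F≗0 (true ∷ x)) (F≗0 (false ∷ x)))
  Δ-zero (false ∷ U) F≗0 = Δ-zero U (λ x → F≗0 (false ∷ x))

  Δ-vanishes : ∀ (U : Subset n) {F} → Deg≤ U d F → d < ∣ U ∣ → Δ U F ≡ 0ℤ
  Δ-vanishes {d = zero}  (true  ∷ U) (_ , ∂F≗0) _           = Δ-zero U ∂F≗0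
  Δ-vanishes {d = suc d} (true  ∷ U) (_ , f∂)   (s≤s d<|U|) = Δ-vanishes U f∂ d<|U|
  Δ-vanishes             (false ∷ U) f₀         d<|U|       = Δ-vanishes U f₀ d<|U|

  module _ (P : ℤ) where

    LighterNonRoot : Subset n → CubeFn n → Set
    LighterNonRoot {n} U F = Σ (Subset n) λ V → ∣ V ∣ < ∣ U ∣ × ¬ P ∣ F V

    P∣0 : P ∣ 0ℤ
    P∣0 = divides 0ℤ refl

    Δ≡top-or-lighterNonRoot : ∀ (U : Subset n) F → LighterNonRoot U F ⊎ P ∣ Δ U F - F U
    Δ≡top-or-lighterNonRoot [] F = inj₂ (subst (P ∣_) (sym (ℤₚ.+-inverseʳ (F []))) P∣0)
    Δ≡top-or-lighterNonRoot (false ∷ U) F with Δ≡top-or-lighterNonRoot U (face₀ F)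
    ... | inj₁ (V , V<U , P∤FV) = inj₁ (false ∷ V , V<U , P∤FV)
    ... | inj₂ P∣Δ-FU           = inj₂ P∣Δ-FU
    Δ≡top-or-lighterNonRoot (true ∷ U) F
      with Δ≡top-or-lighterNonRoot U (∂ F) | P ∣? F (false ∷ U)
    ... | _                       | no  P∤F₀U = inj₁ (false ∷ U , ℕₚ.n<1+n ∣ U ∣ , P∤F₀U)
    ... | inj₂ P∣Δ∂F-∂FU          | yes P∣F₀U =
      inj₂ (subst (P ∣_) (identity (Δ U (∂ F)) (F (true ∷ U)) (F (false ∷ U)))
                  (∣m∣n⇒∣m-n P∣Δ∂F-∂FU P∣F₀U))
      where
      identity : ∀ a b c → (a - (b - c)) - c ≡ a - b
      identity = ℤ-Solver.solve-∀
    ... | inj₁ (V , V<U , P∤∂FV) | yes _ with P ∣? F (false ∷ V)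
    ...   | yes P∣F₀V =
      inj₁ (true ∷ V , s≤s V<U , λ P∣F₁V → P∤∂FV (∣m∣n⇒∣m-n P∣F₁V P∣F₀V))
    ...   | no  P∤F₀V = inj₁ (false ∷ V , ℕₚ.m<n⇒m<1+n V<U , P∤F₀V)

    lighterNonRoot : ∀ (U : Subset n) {F} → Deg≤ U d F → d < ∣ U ∣ → ¬ P ∣ F U →
                     LighterNonRoot U F
    lighterNonRoot U {F} deg d<|U| P∤FU with Δ≡top-or-lighterNonRoot U F
    ... | inj₁ lighter = lighter
    ... | inj₂ P∣Δ-FU  =
      contradiction (subst (P ∣_) (identity (Δ U F) (F U)) (∣m∣n⇒∣m-n P∣Δ P∣Δ-FU)) P∤FU
      where
      identity : ∀ a b → a - (a - b) ≡ b
      identity = ℤ-Solver.solve-∀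
      P∣Δ : P ∣ Δ U F
      P∣Δ = subst (P ∣_) (sym (Δ-vanishes U deg d<|U|)) P∣0

  ⊆ᵇ-true : ∀ {I x : Subset n} → I ⊆ᵇ x ≡ true → ∀ {j} → j ∈ I → lookup x j ≡ true
  ⊆ᵇ-true {I = true  ∷ I} {true ∷ x} I⊆x here        = refl
  ⊆ᵇ-true {I = true  ∷ I} {true ∷ x} I⊆x (there j∈I) = ⊆ᵇ-true I⊆x j∈I
  ⊆ᵇ-true {I = false ∷ I} {_    ∷ x} I⊆x (there j∈I) = ⊆ᵇ-true I⊆x j∈I

  ⊆ᵇ-false : ∀ {I x : Subset n} → I ⊆ᵇ x ≡ false →
             Σ (Fin n) λ j → j ∈ I × lookup x j ≡ false
  ⊆ᵇ-false {I = []}      {[]}        ()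
  ⊆ᵇ-false {I = true  ∷ I} {false ∷ x} _ = Fin.zero , here , refl
  ⊆ᵇ-false {I = true  ∷ I} {true  ∷ x} I⊈x with ⊆ᵇ-false I⊈x
  ... | j , j∈I , xⱼ≡false = Fin.suc j , there j∈I , xⱼ≡false
  ⊆ᵇ-false {I = false ∷ I} {_     ∷ x} I⊈x with ⊆ᵇ-false I⊈x
  ... | j , j∈I , xⱼ≡false = Fin.suc j , there j∈I , xⱼ≡false

module Residues {p : ℕ} (pp : Prime p) where

  open import Data.Nat.DivMod using (_%_; %-distribˡ-+; m%n%n≡m%n; %-remove-+ʳ; m<n⇒m%n≡m)
  open import Data.Fin.Properties using (toℕ-fromℕ<)

  instance
    p≢0 : ℕ.NonZero p
    p≢0 = prime⇒nonZero pp

  P : ℤ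
  P = + p

  toℕ-zeroₚ : toℕ (zeroₚ pp) ≡ 0
  toℕ-zeroₚ = trans (toℕ-fromℕ< _) (m<n⇒m%n≡m (ℕ.>-nonZero⁻¹ p))

  toℕ-∑ₚ : ∀ {X : Set} (L : List X) (h : X → ℤ_ p) →
           toℕ (foldr (addₚ pp) (zeroₚ pp) (map h L)) ≡ sum (map (toℕ ∘ h) L) % p
  toℕ-∑ₚ []      h = toℕ-fromℕ< _
  toℕ-∑ₚ (y ∷ L) h = begin
    toℕ (addₚ pp (h y) (foldr (addₚ pp) (zeroₚ pp) (map h L)))      ≡⟨ toℕ-fromℕ< _ ⟩
    (toℕ (h y) ℕ.+ toℕ (foldr (addₚ pp) (zeroₚ pp) (map h L))) % p
      ≡⟨ cong (λ t → (toℕ (h y) ℕ.+ t) % p) (toℕ-∑ₚ L h) ⟩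
    (t ℕ.+ s % p) % p           ≡⟨ %-distribˡ-+ t (s % p) p ⟩
    (t % p ℕ.+ s % p % p) % p   ≡⟨ cong (λ u → (t % p ℕ.+ u) % p) (m%n%n≡m%n s p) ⟩
    (t % p ℕ.+ s % p) % p       ≡⟨ %-distribˡ-+ t s p ⟨
    (t ℕ.+ s) % p               ∎
    where
    open ≡-Reasoning
    t s : ℕ
    t = toℕ (h y)
    s = sum (map (toℕ ∘ h) L)

  ∣-difference⇒%≡-≥ : ∀ {a b} → b ≤ a → P ∣ + a - + b → a % p ≡ b % p
  ∣-difference⇒%≡-≥ {a} {b} b≤a P∣a-b = begin
    a % p               ≡⟨ cong (_% p) (ℕₚ.m+[n∸m]≡n b≤a) ⟨
    (b ℕ.+ (a ∸ b)) % p ≡⟨ %-remove-+ʳ b p∣a∸b ⟩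
    b % p               ∎
    where
    open ≡-Reasoning
    p∣a∸b : p ℕᵈ.∣ a ∸ b
    p∣a∸b = subst (p ℕᵈ.∣_) (cong ℤ.∣_∣ (trans (ℤₚ.[+m]-[+n]≡m⊖n a b) (ℤₚ.⊖-≥ b≤a)))
                  (∣⇒∣ᵤ P∣a-b)

  ∣-difference⇒%≡ : ∀ {a b} → P ∣ + a - + b → a % p ≡ b % p
  ∣-difference⇒%≡ {a} {b} P∣a-b with ℕₚ.≤-total b a
  ... | inj₁ b≤a = ∣-difference⇒%≡-≥ b≤a P∣a-b
  ... | inj₂ a≤b =
    sym (∣-difference⇒%≡-≥ a≤b (subst (P ∣_) (negated-difference (+ a) (+ b)) (∣m⇒∣-m P∣a-b)))
    where
    negated-difference : ∀ x y → ℤ.- (x - y) ≡ y - x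
    negated-difference = ℤ-Solver.solve-∀

module ChevalleyWarning {p : ℕ} (pp : Prime p) where

  open CubeFunctions
  open Residues pp using (P; p≢0)
  open import Data.Integer using (_*_)
  open import Data.Nat.Primality using (prime⇒nonTrivial; euclidsLemma)
  open import Data.Nat.Tactic.RingSolver using (solve-∀)
  open import Data.Integer.DivMod using (_%ℕ_; _/ℕ_; a≡a%ℕn+[a/ℕn]*n; n%ℕd<d)
  open import Data.Fin using (fromℕ<)
  open import Data.Fin.Properties using (toℕ<n; toℕ-fromℕ<)
  open import Relation.Nullary.Decidable using (decidable-stable)

  1+[p∸1]≡p : suc (p ∸ 1) ≡ p
  1+[p∸1]≡p = ℕₚ.m+[n∸m]≡n (ℕ.>-nonZero⁻¹ p)

  ∤-* : ∀ {x y} → ¬ P ∣ x → ¬ P ∣ y → ¬ P ∣ x * y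
  ∤-* {x} {y} P∤x P∤y P∣xy
    with euclidsLemma ℤ.∣ x ∣ ℤ.∣ y ∣ pp (subst (p ℕᵈ.∣_) (ℤₚ.abs-* x y) (∣⇒∣ᵤ P∣xy))
  ... | inj₁ p∣x = P∤x (∣ᵤ⇒∣ p∣x)
  ... | inj₂ p∣y = P∤y (∣ᵤ⇒∣ p∣y)

  ∤1+ : ∀ {c} → suc c < p → ¬ P ∣ + suc c
  ∤1+ 1+c<p P∣1+c = ℕₚ.<⇒≱ 1+c<p (ℕᵈ.∣⇒≤ (∣⇒∣ᵤ P∣1+c))

  ∣-∏ : ∀ {m} (h : Fin m → ℤ) i → P ∣ h i → P ∣ ∏ h
  ∣-∏ h Fin.zero    P∣h₀ = ∣m⇒∣m*n _ P∣h₀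
  ∣-∏ h (Fin.suc i) P∣hᵢ = ∣n⇒∣m*n (h Fin.zero) (∣-∏ (λ j → h (Fin.suc j)) i P∣hᵢ)

  ∤-∏ : ∀ {m} (h : Fin m → ℤ) → (∀ i → ¬ P ∣ h i) → ¬ P ∣ ∏ h
  ∤-∏ {zero}  h P∤h = ∤1+ (ℕ.nonTrivial⇒n>1 p {{prime⇒nonTrivial pp}})
  ∤-∏ {suc m} h P∤h = ∤-* (P∤h Fin.zero) (∤-∏ (λ i → h (Fin.suc i)) (λ i → P∤h (Fin.suc i)))

  residue : ∀ {m} → Fin m → ℤ
  residue c = + suc (toℕ c)

  ∣⇒∤-residue : ∀ {y} → P ∣ y → (c : Fin (p ∸ 1)) → ¬ P ∣ y - residue c
  ∣⇒∤-residue {y} P∣y c P∣y-c =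
    ∤1+ 1+c<p (subst (P ∣_) (identity y (residue c)) (∣m∣n⇒∣m-n P∣y P∣y-c))
    where
    identity : ∀ a b → a - (a - b) ≡ b
    identity = ℤ-Solver.solve-∀
    1+c<p : suc (toℕ c) < p
    1+c<p = subst (suc (toℕ c) <_) 1+[p∸1]≡p (s≤s (toℕ<n c))

  ∤⇒∣-residue : ∀ {y} → ¬ P ∣ y → Σ (Fin (p ∸ 1)) λ c → P ∣ y - residue c
  ∤⇒∣-residue {y} P∤y with y %ℕ p | a≡a%ℕn+[a/ℕn]*n y p | n%ℕd<d y p
  ... | zero  | y≡0+qP | _ = contradiction (divides (y /ℕ p) (trans y≡0+qP (ℤₚ.+-identityˡ _))) P∤y
  ... | suc r | y≡r+qP | r<p = c , divides (y /ℕ p) (begin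
      y - residue c                    ≡⟨ cong (λ t → y - + suc t) (toℕ-fromℕ< r<p∸1) ⟩
      y - + suc r                      ≡⟨ cong (_- + suc r) y≡r+qP ⟩
      (+ suc r + y /ℕ p * P) - + suc r ≡⟨ identity (+ suc r) (y /ℕ p * P) ⟩
      y /ℕ p * P                       ∎)
    where
    open ≡-Reasoning
    identity : ∀ a b → (a + b) - a ≡ b
    identity = ℤ-Solver.solve-∀
    r<p∸1 : r < p ∸ 1
    r<p∸1 = ℕₚ.≤-pred (subst (suc (suc r) ≤_) (sym 1+[p∸1]≡p) r<p)
    c : Fin (p ∸ 1)
    c = fromℕ< r<p∸1

  -- For fixed i the inner product runs over the nonzero residues c, so it is divisible by p
  -- exactly when y i is not.
  χ : ∀ {m} → (Fin m → ℤ) → ℤ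
  χ y = ∏ λ i → ∏ λ (c : Fin (p ∸ 1)) → y i - residue c

  χ-∤ : ∀ {m} {y : Fin m → ℤ} → (∀ i → P ∣ y i) → ¬ P ∣ χ y
  χ-∤ P∣y = ∤-∏ _ λ i → ∤-∏ _ (∣⇒∤-residue (P∣y i))

  χ-∣ : ∀ {m} {y : Fin m → ℤ} i → ¬ P ∣ y i → P ∣ χ y
  χ-∣ {y = y} i P∤yᵢ =
    let c , P∣yᵢ-c = ∤⇒∣-residue {y i} P∤yᵢ in ∣-∏ _ i (∣-∏ _ c P∣yᵢ-c)

  χ-∤⇒∣ : ∀ {m} {y : Fin m → ℤ} → ¬ P ∣ χ y → ∀ i → P ∣ y i
  χ-∤⇒∣ {y = y} P∤χ i = decidable-stable (P ∣? y i) (λ P∤yᵢ → P∤χ (χ-∣ {y = y} i P∤yᵢ))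

  Deg≤-χ : ∀ {m n d} U (Q : Fin m → CubeFn n) → (∀ i → Deg≤ U d (Q i)) →
           Deg≤ U (m ℕ.* ((p ∸ 1) ℕ.* d)) (λ x → χ λ i → Q i x)
  Deg≤-χ U Q degs =
    Deg≤-∏ U _ λ i → Deg≤-∏ U {p ∸ 1} _ λ c →
      Deg≤-- U (degs i) (Deg≤-mono U z≤n (Deg≤-const U (residue c)))

  boundedCommonRoot : ∀ {m n} d (Q : Fin m → CubeFn n) → (∀ i U → Deg≤ U d (Q i)) →
    (U : Subset n) → (∀ i → P ∣ Q i U) →
    Σ (Subset n) λ V → ∣ V ∣ ≤ d ℕ.* m ℕ.* (p ∸ 1) × (∀ i → P ∣ Q i V)
  boundedCommonRoot {m} {n} d Q degs U roots = descend ∣ U ∣ U ℕₚ.≤-refl roots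
    where
    B : ℕ
    B = d ℕ.* m ℕ.* (p ∸ 1)
    χQ : CubeFn n
    χQ x = χ λ i → Q i x
    Deg≤-χQ : ∀ U → Deg≤ U B χQ
    Deg≤-χQ U = subst (λ t → Deg≤ U t χQ) (reorder m (p ∸ 1) d) (Deg≤-χ U Q λ i → degs i U)
      where
      reorder : ∀ a b c → a ℕ.* (b ℕ.* c) ≡ c ℕ.* a ℕ.* b
      reorder = solve-∀
    descend : ∀ s U → ∣ U ∣ ≤ s → (∀ i → P ∣ Q i U) →
              Σ (Subset n) λ V → ∣ V ∣ ≤ B × (∀ i → P ∣ Q i V)
    descend zero    U |U|≤0 roots = U , ℕₚ.≤-trans |U|≤0 z≤n , roots
    descend (suc s) U |U|≤s roots with ∣ U ∣ ℕₚ.≤? B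
    ... | yes |U|≤B = U , |U|≤B , roots
    ... | no  |U|≰B with lighterNonRoot P U (Deg≤-χQ U) (ℕₚ.≰⇒> |U|≰B) (χ-∤ roots)
    ...   | V , |V|<|U| , P∤χQV =
      descend s V (ℕₚ.≤-pred (ℕₚ.≤-trans |V|<|U| |U|≤s)) (χ-∤⇒∣ P∤χQV)

module Restriction {A B : Set} (z : A) (_⊕_ : B → B → B) (ε : B) where

  open CubeFunctions using (_⊆ᵇ_; ⊆ᵇ-true; ⊆ᵇ-false)
  open import Data.Fin.Subset using (⊤)
  open import Data.Vec.Properties using (lookup-replicate)
  open import Data.List.Properties using (map-cong)

  absorbing-restrict : ∀ {n} {I : Subset n} {g} → Absorbing z _⊕_ ε I g → ∀ a x →
                       g (restrict z a x) ≡ (if I ⊆ᵇ x then g a else ε)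
  absorbing-restrict {I = I} (local , absorbs) a x with I ⊆ᵇ x in I⊆x
  ... | true  = local _ a λ j j∈I → cong (λ b → if b then a j else z) (⊆ᵇ-true I⊆x j∈I)
  ... | false = let j , j∈I , xⱼ≡false = ⊆ᵇ-false I⊆x in
                absorbs _ j j∈I (cong (λ b → if b then a j else z) xⱼ≡false)

  restrict-⊤ : ∀ {n f gs} → IsAbsorbingDecomposition z _⊕_ ε f gs → ∀ (a : Fin n → A) →
               f (restrict z a ⊤) ≡ f a
  restrict-⊤ {n} {f} {gs} (absorbing , decomposes) a = begin
    f (restrict z a ⊤)                                              ≡⟨ decomposes _ ⟩
    foldr _⊕_ ε (map (λ I → gs I (restrict z a ⊤)) (allSubsets n))  ≡⟨ cong (foldr _⊕_ ε) terms ⟩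
    foldr _⊕_ ε (map (λ I → gs I a) (allSubsets n))                 ≡⟨ decomposes a ⟨
    f a                                                              ∎
    where
    open ≡-Reasoning
    restrict-⊤-at : ∀ j → restrict z a ⊤ j ≡ a j
    restrict-⊤-at j = cong (λ b → if b then a j else z) (lookup-replicate j true)
    terms : map (λ I → gs I (restrict z a ⊤)) (allSubsets n) ≡ map (λ I → gs I a) (allSubsets n)
    terms = map-cong (λ I → proj₁ (absorbing I) _ a λ j _ → restrict-⊤-at j) (allSubsets n)

module LiftedPolynomial {A : Set} (z : A) {p : ℕ} (pp : Prime p)
                        {n : ℕ} (gs : Subset n → (Fin n → A) → ℤ_ p) (a : Fin n → A) where

  open CubeFunctions
  open import Data.Integer using (_*_)
  open import Data.Nat.DivMod using (_%_)
  open import Data.Fin.Subset using (⊤)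
  open import Data.Fin.Properties using (toℕ-injective)
  open Residues pp
  open Restriction z (addₚ pp) (zeroₚ pp)

  liftedPoly : CubeFn n
  liftedPoly x = ∑ (allSubsets n) λ I → + toℕ (gs I a) * Ind I x

  differencePoly : CubeFn n
  differencePoly = liftedPoly ⊝ const (liftedPoly ⊤)

  Deg≤-differencePoly : ∀ {k} → (∀ J → k < ∣ J ∣ → gs J a ≡ zeroₚ pp) →
                        ∀ U → Deg≤ U k differencePoly
  Deg≤-differencePoly {k} high U =
    Deg≤-- U (Deg≤-∑ U (allSubsets n) _ term) (Deg≤-mono U z≤n (Deg≤-const U _))
    where
    term : ∀ I → Deg≤ U k (λ x → + toℕ (gs I a) * Ind I x)
    term I with k ℕₚ.<? ∣ I ∣
    ... | yes k<|I| = Deg≤-cong U (λ x → sym (cong (_* Ind I x) coefficient≡0)) (Deg≤-zero U)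
      where
      coefficient≡0 : + toℕ (gs I a) ≡ 0ℤ
      coefficient≡0 = cong +_ (trans (cong toℕ (high I k<|I|)) toℕ-zeroₚ)
    ... | no  k≮|I| =
      Deg≤-* U (Deg≤-const U (+ toℕ (gs I a))) (Deg≤-mono U (ℕₚ.≮⇒≥ k≮|I|) (Deg≤-Ind I U))

  P∣differencePoly-⊤ : P ∣ differencePoly ⊤
  P∣differencePoly-⊤ = subst (P ∣_) (sym (ℤₚ.+-inverseʳ (liftedPoly ⊤))) (P∣0 P)

  module _ {f : (Fin n → A) → ℤ_ p}
           (decomposition : IsAbsorbingDecomposition z (addₚ pp) (zeroₚ pp) f gs) where

    private
      value : Subset n → ℕ
      value x = sum (map (λ I → toℕ (gs I (restrict z a x))) (allSubsets n))

    toℕ-f-restrict : ∀ x → toℕ (f (restrict z a x)) ≡ value x % p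
    toℕ-f-restrict x = trans (cong toℕ (proj₂ decomposition _)) (toℕ-∑ₚ (allSubsets n) _)

    +value≡liftedPoly : ∀ x → + value x ≡ liftedPoly x
    +value≡liftedPoly x = pos-sum (allSubsets n) _ _ term
      where
      term : ∀ I → + toℕ (gs I (restrict z a x)) ≡ + toℕ (gs I a) * Ind I x
      term I with I ⊆ᵇ x | absorbing-restrict (proj₁ decomposition I) a x
      ... | true  | gᵢ≡ = trans (cong (+_ ∘ toℕ) gᵢ≡) (sym (ℤₚ.*-identityʳ (+ toℕ (gs I a))))
      ... | false | gᵢ≡ =
        trans (cong (+_ ∘ toℕ) gᵢ≡) (trans (cong +_ toℕ-zeroₚ) (sym (ℤₚ.*-zeroʳ (+ toℕ (gs I a)))))

    differencePoly-root : ∀ V → P ∣ differencePoly V → f (restrict z a V) ≡ f a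
    differencePoly-root V P∣QV = trans (toℕ-injective (begin
      toℕ (f (restrict z a V)) ≡⟨ toℕ-f-restrict V ⟩
      value V % p              ≡⟨ ∣-difference⇒%≡ (subst (P ∣_) (sym lift) P∣QV) ⟩
      value ⊤ % p              ≡⟨ toℕ-f-restrict ⊤ ⟨
      toℕ (f (restrict z a ⊤)) ∎)) (restrict-⊤ decomposition a)
      where
      open ≡-Reasoning
      lift : + value V - + value ⊤ ≡ differencePoly V
      lift = cong₂ _-_ (+value≡liftedPoly V) (+value≡liftedPoly ⊤)

open import Data.Nat using (_*_)
open import Data.Fin.Subset using (⊤)
open CubeFunctions using (CubeFn; Deg≤)

theorem3p3 : (A : Set) (z : A) (p : ℕ) (pp : Prime p) (k n m : ℕ) → 1 ≤ n → 1 ≤ m →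
    (f : Fin m → (Fin n → A) → ℤ_ p) →
    ((i : Fin m) → AdegAtMost z (addₚ pp) (zeroₚ pp) k (f i)) →
    (a : Fin n → A) →
    Σ (Subset n) λ U → (∣ U ∣ ≤ k * m * (p ∸ 1))
    × ((i : Fin m) → f i a ≡ f i (restrict z a U))
theorem3p3 A z p pp k n m _ _ f adeg a =
  let V , |V|≤kmp , roots = boundedCommonRoot k Q Deg≤-Q ⊤ (λ i → L.P∣differencePoly-⊤ i)
  in  V , |V|≤kmp , λ i → sym (L.differencePoly-root i (proj₁ (proj₂ (adeg i))) V (roots i))
  where
  open ChevalleyWarning pp using (boundedCommonRoot)
  module L (i : Fin m) = LiftedPolynomial z pp (proj₁ (adeg i)) a
  Q : Fin m → CubeFn n
  Q = L.differencePoly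
  Deg≤-Q : ∀ i U → Deg≤ U k (Q i)
  Deg≤-Q i = L.Deg≤-differencePoly i λ J k<|J| → proj₂ (proj₂ (adeg i)) J k<|J| a
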